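{- Let $G=(V,E)$ be a directed hypergraph with $\Omega\neq\emptyset$, and let $n\ge1$. Consider the algorithm CODA-A: set $C[i]=0$ for all $i\in[m]$ and $w[v]=\binom{d_v}{2}$ for all $v\in V$, and let $W=\sum_{v\in V}w[v]$; repeat $n$ times independently: choose a node $v$ with probability $w[v]/W$, then choose an unordered pair $\{e,e'\}$ of distinct hyperarcs in $E_v$ uniformly at random (among the $\binom{d_v}{2}$ such pairs), and add $\frac{W}{n\cdot|\bar e\cap\bar e'|}$ to $C[f(e,e')]$; return $C$. Then for every $i\in[m]$, $\mathbb{E}[C[i]]=|\Omega_i|$.
   Context: A directed hypergraph $G=(V,E)$ consists of a finite node set $V$ and a finite set $E$ of distinct hyperarcs; each hyperarc $e=\langle T,H\rangle$ is an ordered pair of a tail set $T\subseteq V$ and a head set $H\subseteq V$ with $T\cap H=\emptyset$; write $\bar e=T\cup H$, $E_v=\{e\in E: v\in\bar e\}$ and $d_v=|E_v|$. Let $\Omega$ be the set of unordered pairs $\{e,e'\}$ of distinct hyperarcs with $\bar e\cap\bar e'\neq\emptyset$. The $m=91$ directed hypergraphlets (DHGs) classify pairs in $\Omega$ by the emptiness pattern of the eight sets $H\setminus H'\setminus T'$, $H\cap H'$, $H\cap T'$, $H'\setminus H\setminus T$, $T'\setminus H\setminus T$, $H'\cap T$, $T\cap T'$, $T\setminus H'\setminus T'$ (for $e=\langle T,H\rangle$, $e'=\langle T',H'\rangle$), up to swapping $e$ and $e'$; $f:\Omega\to[m]$ gives the DHG index and $\Omega_i=\{(e,e')\in\Omega:f(e,e')=i\}$.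 -}

module Defs where

open import Data.Nat as ℕ using (ℕ; zero; suc; _<ᵇ_)
open import Data.Nat.Combinatorics using (_C_)
open import Data.Bool using (Bool; true; false; if_then_else_; _∧_; _∨_; not)
open import Data.Fin using (Fin; toℕ)
open import Data.Fin.Subset using (Subset; _∩_; _∪_; ∁; ⊥; ∣_∣)
open import Data.Vec using (Vec; []; _∷_; lookup)
open import Data.List using (List; []; _∷_; allFin; concatMap; filter; length; map; foldr; _++_)
open import Data.Product using (_×_; _,_; proj₁; proj₂)
open import Data.Integer using (+_)
open import Data.Rational using (ℚ; 0ℚ; 1ℚ; _+_; _*_; _÷_; ≢-nonZero) renaming (_/_ to _//_)
open import Data.Rational.Properties using (_≟_)
open import Relation.Nullary using (yes; no)
open import Relation.Binary.PropositionalEquality using (_≡_)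

record DHypergraph (N K : ℕ) : Set where
  field
    tl       : Fin K → Subset N
    hd       : Fin K → Subset N
    disjoint : ∀ a → tl a ∩ hd a ≡ ⊥
    distinct : ∀ a b → tl a ≡ tl b → hd a ≡ hd b → a ≡ b

module _ {N K : ℕ} (G : DHypergraph N K) where
  open DHypergraph G

  ebar : Fin K → Subset N
  ebar a = tl a ∪ hd a

  deg : Fin N → ℕ
  deg v = length (filter (λ a → Data.Bool._≟_ (lookup (ebar a) v) true) (allFin K))

  weight : Fin N → ℕ
  weight v = deg v C 2

  totalW : ℕ
  totalW = foldr ℕ._+_ 0 (map weight (allFin N))

  -- unordered pairs of distinct hyperarcs, represented as (a , b) with a < b
  pairs : List (Fin K × Fin K)
  pairs = concatMap (λ a → map (a ,_) (filter (λ b → Data.Bool._≟_ (toℕ a <ᵇ toℕ b) true) (allFin K))) (allFin K)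

  meetSize : Fin K × Fin K → ℕ
  meetSize (a , b) = ∣ ebar a ∩ ebar b ∣

  Ω : List (Fin K × Fin K)
  Ω = filter (λ p → Data.Bool._≟_ (0 <ᵇ meetSize p) true) pairs

nonemptyᵇ : ∀ {N} → Subset N → Bool
nonemptyᵇ s = 0 <ᵇ ∣ s ∣

_∖_ : ∀ {N} → Subset N → Subset N → Subset N
A ∖ B = A ∩ ∁ B

pattern8 : ∀ {N} → (T H T' H' : Subset N) → Vec Bool 8
pattern8 T H T' H' =
  nonemptyᵇ ((H ∖ H') ∖ T') ∷ nonemptyᵇ (H ∩ H') ∷ nonemptyᵇ (H ∩ T') ∷
  nonemptyᵇ ((H' ∖ H) ∖ T) ∷ nonemptyᵇ ((T' ∖ H) ∖ T) ∷ nonemptyᵇ (H' ∩ T) ∷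
  nonemptyᵇ (T ∩ T') ∷ nonemptyᵇ ((T ∖ H') ∖ T') ∷ []

lexLeq : ∀ {n} → Vec Bool n → Vec Bool n → Bool
lexLeq [] [] = true
lexLeq (false ∷ xs) (false ∷ ys) = lexLeq xs ys
lexLeq (true  ∷ xs) (true  ∷ ys) = lexLeq xs ys
lexLeq (false ∷ xs) (true  ∷ ys) = true
lexLeq (true  ∷ xs) (false ∷ ys) = false

-- DHG label: the emptiness pattern up to swapping e and e',
-- represented canonically by the lexicographically smaller of the two patterns.
DHG : Set
DHG = Vec Bool 8

vecEqᵇ : ∀ {n} → Vec Bool n → Vec Bool n → Bool
vecEqᵇ [] [] = true
vecEqᵇ (x ∷ xs) (y ∷ ys) = (if x then y else not y) ∧ vecEqᵇ xs ys

module _ {N K : ℕ} (G : DHypergraph N K) where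
  open DHypergraph G

  dhg : Fin K × Fin K → DHG
  dhg (a , b) =
    let p = pattern8 (tl a) (hd a) (tl b) (hd b)
        q = pattern8 (tl b) (hd b) (tl a) (hd a)
    in if lexLeq p q then p else q

  Ωᵢ : DHG → List (Fin K × Fin K)
  Ωᵢ i = filter (λ p → Data.Bool._≟_ (vecEqᵇ (dhg p) i) true) (Ω G)

-- total division on ℚ (x / 0 = 0); only ever applied to nonzero denominators below
_÷'_ : ℚ → ℚ → ℚ
p ÷' q with q ≟ 0ℚ
... | yes _ = 0ℚ
... | no q≢0 = _÷_ p q {{≢-nonZero q≢0}}

ℕtoℚ : ℕ → ℚ
ℕtoℚ k = (+ k) // 1

sumℚ : List ℚ → ℚ
sumℚ = foldr _+_ 0ℚ

prodℚ : List ℚ → ℚ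
prodℚ = foldr _*_ 1ℚ

Dist : Set → Set
Dist A = List (A × ℚ)

iid : ∀ {A : Set} → ℕ → Dist A → Dist (List A)
iid zero    D = ([] , 1ℚ) ∷ []
iid (suc n) D = concatMap (λ { (x , p) → map (λ { (xs , q) → (x ∷ xs , p * q) }) (iid n D) }) D

expect : ∀ {A : Set} → Dist A → (A → ℚ) → ℚ
expect D X = sumℚ (map (λ { (x , p) → p * X x }) D)

module _ {N K : ℕ} (G : DHypergraph N K) where

  pairsAt : Fin N → List (Fin K × Fin K)
  pairsAt v = filter (λ { (a , b) → Data.Bool._≟_ (lookup (ebar G a) v ∧ lookup (ebar G b) v) true }) (pairs G)

  step : Dist (Fin N × (Fin K × Fin K))
  step = concatMap (λ v → map (λ pr → ((v , pr) ,
                     (ℕtoℚ (weight G v) ÷' ℕtoℚ (totalW G)) * (1ℚ ÷' ℕtoℚ (deg G v C 2))))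
                     (pairsAt v))
                   (allFin N)

  increment : ℕ → DHG → Fin N × (Fin K × Fin K) → ℚ
  increment n i (v , pr) =
    if vecEqᵇ (dhg G pr) i
    then ℕtoℚ (totalW G) ÷' ℕtoℚ (n ℕ.* meetSize G pr)
    else 0ℚ

  counterC : ℕ → DHG → List (Fin N × (Fin K × Fin K)) → ℚ
  counterC n i samples = sumℚ (map (increment n i) samples)

  expectedC : ℕ → DHG → ℚ
  expectedC n i = expect (iid n step) (counterC n i)

-- Sampling a node v with probability w[v]/W and then one of the C(d_v,2) pairs
-- of E_v uniformly gives each pair {e,e'} total probability |ē ∩ ē'|/W, since
-- the pair lies in E_v for exactly the nodes v ∈ ē ∩ ē' (and double counting the
-- same incidences shows W = Σ |ē ∩ ē'|).  The increment W/(n|ē ∩ ē'|) therefore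
-- exactly compensates the sampling probability, so one sample contributes
-- |Ωᵢ|/n to C[i] in expectation, and linearity over the n samples gives |Ωᵢ|.

module Submission where

open import Defs
open import Data.Nat as ℕ using (ℕ; zero; suc; _<_; _≤_; _≥_; _<ᵇ_; z≤n; s≤s)
import Data.Nat.Properties as ℕ
open import Data.Nat.Combinatorics using (_C_; nC1≡n; nCk+nC[k+1]≡[n+1]C[k+1])
import Data.Nat.Coprimality as Coprimality
open import Data.Bool using (Bool; true; false; _∧_; if_then_else_) renaming (_≟_ to _≟ᵇ_)
open import Data.Fin using (Fin; toℕ) renaming (zero to fzero; suc to fsuc)
open import Data.Fin.Subset using (Subset; _∩_; ∣_∣)
open import Data.Vec using ([]; _∷_; lookup)
open import Data.List using (List; []; _∷_; _++_; map; concatMap; filter; length; allFin; foldr)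
open import Data.List.Properties using (map-tabulate)
open import Data.Product using (_×_; _,_; proj₁; proj₂)
import Data.Integer as ℤ
import Data.Integer.Properties as ℤ
open import Data.Rational using (ℚ; mkℚ; 0ℚ; 1ℚ; _+_; _*_; ↥_; ≢-nonZero)
open import Data.Rational.Properties
open import Data.Rational.Solver using (module +-*-Solver)
open import Relation.Nullary using (yes; no; contradiction)
open import Relation.Binary.PropositionalEquality
open import Function using (id; _∘_)
open import Algebra.Bundles using (CommutativeMonoid)
import Algebra.Properties.CommutativeSemigroup as CommSemigroupProperties
open CommSemigroupProperties (CommutativeMonoid.commutativeSemigroup +-0-commutativeMonoid)
  using (interchange)
open CommSemigroupProperties (CommutativeMonoid.commutativeSemigroup *-1-commutativeMonoid)
  using (xy∙z≈xz∙y)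

open ≡-Reasoning

ℕtoℚ≡mkℚ : ∀ k → ℕtoℚ k ≡ mkℚ (ℤ.+ k) 0 (Coprimality.sym (Coprimality.1-coprimeTo k))
ℕtoℚ≡mkℚ k = normalize-coprime (Coprimality.sym (Coprimality.1-coprimeTo k))

ℕtoℚ-suc : ∀ k → ℕtoℚ (suc k) ≡ 1ℚ + ℕtoℚ k
ℕtoℚ-suc k rewrite ℕtoℚ≡mkℚ k =
  /-cong (cong (λ z → ℤ.+ 1 ℤ.+ z) (sym (ℤ.*-identityʳ (ℤ.+ k)))) refl

ℕtoℚ-injective : ∀ {a b} → ℕtoℚ a ≡ ℕtoℚ b → a ≡ b
ℕtoℚ-injective {a} {b} eq rewrite ℕtoℚ≡mkℚ a | ℕtoℚ≡mkℚ b = ℤ.+-injective (cong ↥_ eq)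

ℕtoℚ-≢0 : ∀ {k} → k ≢ 0 → ℕtoℚ k ≢ 0ℚ
ℕtoℚ-≢0 k≢0 = k≢0 ∘ ℕtoℚ-injective

ℕtoℚ-+ : ∀ a b → ℕtoℚ (a ℕ.+ b) ≡ ℕtoℚ a + ℕtoℚ b
ℕtoℚ-+ zero    b = sym (+-identityˡ (ℕtoℚ b))
ℕtoℚ-+ (suc a) b = begin
  ℕtoℚ (suc (a ℕ.+ b))    ≡⟨ ℕtoℚ-suc (a ℕ.+ b) ⟩
  1ℚ + ℕtoℚ (a ℕ.+ b)     ≡⟨ cong (1ℚ +_) (ℕtoℚ-+ a b) ⟩
  1ℚ + (ℕtoℚ a + ℕtoℚ b)  ≡⟨ +-assoc 1ℚ (ℕtoℚ a) (ℕtoℚ b) ⟨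
  (1ℚ + ℕtoℚ a) + ℕtoℚ b  ≡⟨ cong (_+ ℕtoℚ b) (ℕtoℚ-suc a) ⟨
  ℕtoℚ (suc a) + ℕtoℚ b   ∎

ℕtoℚ-* : ∀ a b → ℕtoℚ (a ℕ.* b) ≡ ℕtoℚ a * ℕtoℚ b
ℕtoℚ-* zero    b = sym (*-zeroˡ (ℕtoℚ b))
ℕtoℚ-* (suc a) b = begin
  ℕtoℚ (b ℕ.+ a ℕ.* b)          ≡⟨ ℕtoℚ-+ b (a ℕ.* b) ⟩
  ℕtoℚ b + ℕtoℚ (a ℕ.* b)       ≡⟨ cong (ℕtoℚ b +_) (ℕtoℚ-* a b) ⟩
  ℕtoℚ b + ℕtoℚ a * ℕtoℚ b      ≡⟨ cong (_+ ℕtoℚ a * ℕtoℚ b) (*-identityˡ (ℕtoℚ b)) ⟨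
  1ℚ * ℕtoℚ b + ℕtoℚ a * ℕtoℚ b ≡⟨ *-distribʳ-+ (ℕtoℚ b) 1ℚ (ℕtoℚ a) ⟨
  (1ℚ + ℕtoℚ a) * ℕtoℚ b        ≡⟨ cong (_* ℕtoℚ b) (ℕtoℚ-suc a) ⟨
  ℕtoℚ (suc a) * ℕtoℚ b         ∎

÷'≡*1÷' : ∀ p q → p ÷' q ≡ p * (1ℚ ÷' q)
÷'≡*1÷' p q with q ≟ 0ℚ
... | yes _ = sym (*-zeroʳ p)
... | no  _ = cong (p *_) (sym (*-identityˡ _))

*-1÷'-inverseʳ : ∀ {q} → q ≢ 0ℚ → q * (1ℚ ÷' q) ≡ 1ℚ
*-1÷'-inverseʳ {q} q≢0 with q ≟ 0ℚ
... | yes q≡0 = contradiction q≡0 q≢0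
... | no  q≢0′ = trans (cong (q *_) (*-identityˡ _)) (*-inverseʳ q {{≢-nonZero q≢0′}})

÷'-*-1÷'-cancel : ∀ {a} b → a ≢ 0ℚ → (a ÷' b) * (1ℚ ÷' a) ≡ 1ℚ ÷' b
÷'-*-1÷'-cancel {a} b a≢0 = begin
  (a ÷' b) * (1ℚ ÷' a)               ≡⟨ cong (_* (1ℚ ÷' a)) (÷'≡*1÷' a b) ⟩
  (a * (1ℚ ÷' b)) * (1ℚ ÷' a)        ≡⟨ xy∙z≈xz∙y a (1ℚ ÷' b) (1ℚ ÷' a) ⟩
  (a * (1ℚ ÷' a)) * (1ℚ ÷' b)        ≡⟨ cong (_* (1ℚ ÷' b)) (*-1÷'-inverseʳ a≢0) ⟩
  1ℚ * (1ℚ ÷' b)                     ≡⟨ *-identityˡ (1ℚ ÷' b) ⟩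
  1ℚ ÷' b                            ∎

∑ : ∀ {A : Set} → List A → (A → ℚ) → ℚ
∑ xs f = sumℚ (map f xs)

syntax ∑ xs (λ x → e) = ∑[ x ∈ xs ] e

𝟙 : Bool → ℚ
𝟙 true  = 1ℚ
𝟙 false = 0ℚ

filterᵇ : ∀ {A : Set} → (A → Bool) → List A → List A
filterᵇ p = filter (λ x → p x ≟ᵇ true)

module _ {A : Set} where

  ∑-cong : ∀ (xs : List A) {f g : A → ℚ} → (∀ x → f x ≡ g x) → ∑ xs f ≡ ∑ xs g
  ∑-cong []       f≗g = refl
  ∑-cong (x ∷ xs) f≗g = cong₂ _+_ (f≗g x) (∑-cong xs f≗g)

  ∑-cong-nonEmpty : ∀ (xs : List A) {f g : A → ℚ} →
                    (0 < length xs → ∀ x → f x ≡ g x) → ∑ xs f ≡ ∑ xs g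
  ∑-cong-nonEmpty []       f≗g = refl
  ∑-cong-nonEmpty (x ∷ xs) f≗g = ∑-cong (x ∷ xs) (f≗g (s≤s z≤n))

  ∑-zero : ∀ (xs : List A) → ∑[ _ ∈ xs ] 0ℚ ≡ 0ℚ
  ∑-zero []       = refl
  ∑-zero (x ∷ xs) = trans (+-identityˡ _) (∑-zero xs)

  ∑-+ : ∀ (xs : List A) (f g : A → ℚ) → ∑[ x ∈ xs ] (f x + g x) ≡ ∑ xs f + ∑ xs g
  ∑-+ []       f g = refl
  ∑-+ (x ∷ xs) f g = begin
    (f x + g x) + ∑[ x ∈ xs ] (f x + g x) ≡⟨ cong ((f x + g x) +_) (∑-+ xs f g) ⟩
    (f x + g x) + (∑ xs f + ∑ xs g)       ≡⟨ interchange (f x) (g x) (∑ xs f) (∑ xs g) ⟩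
    (f x + ∑ xs f) + (g x + ∑ xs g)       ∎

  ∑-*ˡ : ∀ (xs : List A) c (f : A → ℚ) → ∑[ x ∈ xs ] (c * f x) ≡ c * ∑ xs f
  ∑-*ˡ []       c f = sym (*-zeroʳ c)
  ∑-*ˡ (x ∷ xs) c f =
    trans (cong (c * f x +_) (∑-*ˡ xs c f)) (sym (*-distribˡ-+ c (f x) (∑ xs f)))

  ∑-*ʳ : ∀ (xs : List A) c (f : A → ℚ) → ∑[ x ∈ xs ] (f x * c) ≡ ∑ xs f * c
  ∑-*ʳ xs c f =
    trans (∑-cong xs (λ x → *-comm (f x) c)) (trans (∑-*ˡ xs c f) (*-comm c (∑ xs f)))

  ∑-++ : ∀ (xs ys : List A) (f : A → ℚ) → ∑ (xs ++ ys) f ≡ ∑ xs f + ∑ ys f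
  ∑-++ []       ys f = sym (+-identityˡ _)
  ∑-++ (x ∷ xs) ys f =
    trans (cong (f x +_) (∑-++ xs ys f)) (sym (+-assoc (f x) (∑ xs f) (∑ ys f)))

  ∑-filterᵇ : ∀ (xs : List A) (p : A → Bool) (f : A → ℚ) →
              ∑ (filterᵇ p xs) f ≡ ∑[ x ∈ xs ] (𝟙 (p x) * f x)
  ∑-filterᵇ []       p f = refl
  ∑-filterᵇ (x ∷ xs) p f with p x
  ... | true  = cong₂ _+_ (sym (*-identityˡ (f x))) (∑-filterᵇ xs p f)
  ... | false = trans (∑-filterᵇ xs p f)
                      (sym (trans (cong (_+ _) (*-zeroˡ (f x))) (+-identityˡ _)))

  ℕtoℚ-length : ∀ (xs : List A) → ℕtoℚ (length xs) ≡ ∑[ _ ∈ xs ] 1ℚ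
  ℕtoℚ-length []       = refl
  ℕtoℚ-length (x ∷ xs) = trans (ℕtoℚ-suc (length xs)) (cong (1ℚ +_) (ℕtoℚ-length xs))

  ℕtoℚ-length-filterᵇ : ∀ (xs : List A) (p : A → Bool) →
                        ℕtoℚ (length (filterᵇ p xs)) ≡ ∑[ x ∈ xs ] 𝟙 (p x)
  ℕtoℚ-length-filterᵇ xs p = begin
    ℕtoℚ (length (filterᵇ p xs))   ≡⟨ ℕtoℚ-length (filterᵇ p xs) ⟩
    ∑[ _ ∈ filterᵇ p xs ] 1ℚ       ≡⟨ ∑-filterᵇ xs p (λ _ → 1ℚ) ⟩
    ∑[ x ∈ xs ] (𝟙 (p x) * 1ℚ)     ≡⟨ ∑-cong xs (λ x → *-identityʳ (𝟙 (p x))) ⟩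
    ∑[ x ∈ xs ] 𝟙 (p x)            ∎

  ℕtoℚ-sum : ∀ (xs : List A) (f : A → ℕ) →
             ℕtoℚ (foldr ℕ._+_ 0 (map f xs)) ≡ ∑[ x ∈ xs ] ℕtoℚ (f x)
  ℕtoℚ-sum []       f = refl
  ℕtoℚ-sum (x ∷ xs) f = trans (ℕtoℚ-+ (f x) _) (cong (ℕtoℚ (f x) +_) (ℕtoℚ-sum xs f))

module _ {A B : Set} where

  ∑-map : ∀ (xs : List A) (g : A → B) (f : B → ℚ) → ∑ (map g xs) f ≡ ∑[ x ∈ xs ] f (g x)
  ∑-map []       g f = refl
  ∑-map (x ∷ xs) g f = cong (f (g x) +_) (∑-map xs g f)

  ∑-concatMap : ∀ (xs : List A) (g : A → List B) (f : B → ℚ) →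
                ∑ (concatMap g xs) f ≡ ∑[ x ∈ xs ] ∑ (g x) f
  ∑-concatMap []       g f = refl
  ∑-concatMap (x ∷ xs) g f =
    trans (∑-++ (g x) (concatMap g xs) f) (cong (∑ (g x) f +_) (∑-concatMap xs g f))

  ∑-comm : ∀ (xs : List A) (ys : List B) (f : A → B → ℚ) →
           ∑[ x ∈ xs ] ∑[ y ∈ ys ] f x y ≡ ∑[ y ∈ ys ] ∑[ x ∈ xs ] f x y
  ∑-comm []       ys f = sym (∑-zero ys)
  ∑-comm (x ∷ xs) ys f =
    trans (cong (∑ ys (f x) +_) (∑-comm xs ys f)) (sym (∑-+ ys (f x) (λ y → ∑[ x ∈ xs ] f x y)))

∑-allFin-suc : ∀ K (f : Fin (suc K) → ℚ) →
               ∑ (allFin (suc K)) f ≡ f fzero + ∑[ a ∈ allFin K ] f (fsuc a)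
∑-allFin-suc K f =
  cong (λ ys → f fzero + sumℚ ys) (trans (map-tabulate fsuc f) (sym (map-tabulate id (f ∘ fsuc))))

𝟙-∧ : ∀ a b → 𝟙 (a ∧ b) ≡ 𝟙 a * 𝟙 b
𝟙-∧ true  b = sym (*-identityˡ (𝟙 b))
𝟙-∧ false b = sym (*-zeroˡ (𝟙 b))

∑-both-∈≡∣∩∣ : ∀ {N} (s t : Subset N) →
               ∑[ v ∈ allFin N ] 𝟙 (lookup s v ∧ lookup t v) ≡ ℕtoℚ ∣ s ∩ t ∣
∑-both-∈≡∣∩∣ {zero}  []      []      = refl
∑-both-∈≡∣∩∣ {suc N} (x ∷ s) (y ∷ t) =
  trans (∑-allFin-suc N (λ v → 𝟙 (lookup (x ∷ s) v ∧ lookup (y ∷ t) v)))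
        (trans (cong (𝟙 (x ∧ y) +_) (∑-both-∈≡∣∩∣ s t)) (head-step x y))
  where
  head-step : ∀ x y → 𝟙 (x ∧ y) + ℕtoℚ ∣ s ∩ t ∣ ≡ ℕtoℚ ∣ (x ∷ s) ∩ (y ∷ t) ∣
  head-step true  true  = sym (ℕtoℚ-suc ∣ s ∩ t ∣)
  head-step true  false = +-identityˡ _
  head-step false y     = +-identityˡ _

length-filter-pos≤sum : ∀ {A : Set} (xs : List A) (m : A → ℕ) →
                        length (filterᵇ (λ x → 0 <ᵇ m x) xs) ≤ foldr ℕ._+_ 0 (map m xs)
length-filter-pos≤sum []       m = z≤n
length-filter-pos≤sum (x ∷ xs) m with m x
... | zero  = length-filter-pos≤sum xs m
... | suc k = s≤s (ℕ.≤-trans (length-filter-pos≤sum xs m) (ℕ.m≤n+m _ k))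

-- `deg G v` and `pairs G` unfold to `count` and `orderedPairs K`, so the
-- counting lemmas below apply to them directly.

count : ∀ {K} → (Fin K → Bool) → ℕ
count {K} q = length (filterᵇ q (allFin K))

orderedPairs : ∀ K → List (Fin K × Fin K)
orderedPairs K =
  concatMap (λ a → map (a ,_) (filterᵇ (λ b → toℕ a <ᵇ toℕ b) (allFin K))) (allFin K)

pairCount : ∀ {K} → (Fin K → Bool) → ℚ
pairCount {K} q = ∑[ a ∈ allFin K ] ∑[ b ∈ allFin K ] (𝟙 (toℕ a <ᵇ toℕ b) * 𝟙 (q a ∧ q b))

ℕtoℚ-if-suc : ∀ b c → ℕtoℚ (if b then suc c else c) ≡ 𝟙 b + ℕtoℚ c
ℕtoℚ-if-suc true  c = ℕtoℚ-suc c
ℕtoℚ-if-suc false c = sym (+-identityˡ (ℕtoℚ c))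

count-suc : ∀ {K} (q : Fin (suc K) → Bool) →
            count q ≡ (if q fzero then suc (count (q ∘ fsuc)) else count (q ∘ fsuc))
count-suc {K} q = ℕtoℚ-injective (begin
  ℕtoℚ (count q)
    ≡⟨ ℕtoℚ-length-filterᵇ (allFin (suc K)) q ⟩
  ∑[ a ∈ allFin (suc K) ] 𝟙 (q a)
    ≡⟨ ∑-allFin-suc K (𝟙 ∘ q) ⟩
  𝟙 (q fzero) + ∑[ a ∈ allFin K ] 𝟙 (q (fsuc a))
    ≡⟨ cong (𝟙 (q fzero) +_) (ℕtoℚ-length-filterᵇ (allFin K) (q ∘ fsuc)) ⟨
  𝟙 (q fzero) + ℕtoℚ (count (q ∘ fsuc))
    ≡⟨ ℕtoℚ-if-suc (q fzero) _ ⟨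
  ℕtoℚ (if q fzero then suc (count (q ∘ fsuc)) else count (q ∘ fsuc)) ∎)

ℕtoℚ-length-pairsWithin : ∀ {K} (q : Fin K → Bool) →
  ℕtoℚ (length (filterᵇ (λ p → q (proj₁ p) ∧ q (proj₂ p)) (orderedPairs K))) ≡ pairCount q
ℕtoℚ-length-pairsWithin {K} q = begin
  ℕtoℚ (length (filterᵇ both (orderedPairs K)))  ≡⟨ ℕtoℚ-length-filterᵇ (orderedPairs K) both ⟩
  ∑ (orderedPairs K) (𝟙 ∘ both)                  ≡⟨ ∑-concatMap (allFin K) _ (𝟙 ∘ both) ⟩
  ∑[ a ∈ allFin K ] ∑ (map (a ,_) (later a)) (𝟙 ∘ both)
    ≡⟨ ∑-cong (allFin K) (λ a → ∑-map (later a) (a ,_) (𝟙 ∘ both)) ⟩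
  ∑[ a ∈ allFin K ] ∑[ b ∈ later a ] 𝟙 (q a ∧ q b)
    ≡⟨ ∑-cong (allFin K) (λ a →
         ∑-filterᵇ (allFin K) (λ b → toℕ a <ᵇ toℕ b) (λ b → 𝟙 (q a ∧ q b))) ⟩
  pairCount q                                    ∎
  where
  both : Fin K × Fin K → Bool
  both p = q (proj₁ p) ∧ q (proj₂ p)
  later : Fin K → List (Fin K)
  later a = filterᵇ (λ b → toℕ a <ᵇ toℕ b) (allFin K)

pairCount-suc : ∀ {K} (q : Fin (suc K) → Bool) →
  pairCount q ≡ 𝟙 (q fzero) * ℕtoℚ (count (q ∘ fsuc)) + pairCount (q ∘ fsuc)
pairCount-suc {K} q = begin
  pairCount q
    ≡⟨ ∑-allFin-suc K row ⟩
  row fzero + ∑[ a ∈ allFin K ] row (fsuc a)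
    ≡⟨ cong₂ _+_ first-row (∑-cong (allFin K) later-row) ⟩
  𝟙 (q fzero) * ℕtoℚ (count (q ∘ fsuc)) + pairCount (q ∘ fsuc) ∎
  where
  entry : Fin (suc K) → Fin (suc K) → ℚ
  entry a b = 𝟙 (toℕ a <ᵇ toℕ b) * 𝟙 (q a ∧ q b)
  row : Fin (suc K) → ℚ
  row a = ∑ (allFin (suc K)) (entry a)

  first-row : row fzero ≡ 𝟙 (q fzero) * ℕtoℚ (count (q ∘ fsuc))
  first-row = begin
    row fzero
      ≡⟨ ∑-allFin-suc K (entry fzero) ⟩
    0ℚ * 𝟙 (q fzero ∧ q fzero) + ∑[ b ∈ allFin K ] (1ℚ * 𝟙 (q fzero ∧ q (fsuc b)))
      ≡⟨ cong₂ _+_ (*-zeroˡ (𝟙 (q fzero ∧ q fzero)))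
                   (∑-cong (allFin K) (λ b → trans (*-identityˡ _) (𝟙-∧ (q fzero) (q (fsuc b))))) ⟩
    0ℚ + ∑[ b ∈ allFin K ] (𝟙 (q fzero) * 𝟙 (q (fsuc b)))
      ≡⟨ +-identityˡ _ ⟩
    ∑[ b ∈ allFin K ] (𝟙 (q fzero) * 𝟙 (q (fsuc b)))
      ≡⟨ ∑-*ˡ (allFin K) (𝟙 (q fzero)) (𝟙 ∘ q ∘ fsuc) ⟩
    𝟙 (q fzero) * ∑[ b ∈ allFin K ] 𝟙 (q (fsuc b))
      ≡⟨ cong (𝟙 (q fzero) *_) (ℕtoℚ-length-filterᵇ (allFin K) (q ∘ fsuc)) ⟨
    𝟙 (q fzero) * ℕtoℚ (count (q ∘ fsuc)) ∎

  later-row : ∀ a → row (fsuc a) ≡ ∑[ b ∈ allFin K ] entry (fsuc a) (fsuc b)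
  later-row a =
    trans (∑-allFin-suc K (entry (fsuc a)))
          (trans (cong (_+ ∑[ b ∈ allFin K ] entry (fsuc a) (fsuc b))
                       (*-zeroˡ (𝟙 (q (fsuc a) ∧ q fzero))))
                 (+-identityˡ _))

ℕtoℚ-choose-2-if-suc : ∀ b c →
  𝟙 b * ℕtoℚ c + ℕtoℚ (c C 2) ≡ ℕtoℚ ((if b then suc c else c) C 2)
ℕtoℚ-choose-2-if-suc true  c = begin
  1ℚ * ℕtoℚ c + ℕtoℚ (c C 2)
    ≡⟨ cong (_+ ℕtoℚ (c C 2)) (trans (*-identityˡ _) (cong ℕtoℚ (sym (nC1≡n c)))) ⟩
  ℕtoℚ (c C 1) + ℕtoℚ (c C 2)
    ≡⟨ ℕtoℚ-+ (c C 1) (c C 2) ⟨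
  ℕtoℚ (c C 1 ℕ.+ c C 2)
    ≡⟨ cong ℕtoℚ (nCk+nC[k+1]≡[n+1]C[k+1] c 1) ⟩
  ℕtoℚ (suc c C 2) ∎
ℕtoℚ-choose-2-if-suc false c = trans (cong (_+ ℕtoℚ (c C 2)) (*-zeroˡ (ℕtoℚ c))) (+-identityˡ _)

pairCount≡count-choose-2 : ∀ {K} (q : Fin K → Bool) → pairCount q ≡ ℕtoℚ (count q C 2)
pairCount≡count-choose-2 {zero}  q = refl
pairCount≡count-choose-2 {suc K} q = begin
  pairCount q
    ≡⟨ pairCount-suc q ⟩
  𝟙 (q fzero) * ℕtoℚ c + pairCount (q ∘ fsuc)
    ≡⟨ cong (𝟙 (q fzero) * ℕtoℚ c +_) (pairCount≡count-choose-2 (q ∘ fsuc)) ⟩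
  𝟙 (q fzero) * ℕtoℚ c + ℕtoℚ (c C 2)
    ≡⟨ ℕtoℚ-choose-2-if-suc (q fzero) c ⟩
  ℕtoℚ ((if q fzero then suc c else c) C 2)
    ≡⟨ cong (λ k → ℕtoℚ (k C 2)) (count-suc q) ⟨
  ℕtoℚ (count q C 2) ∎
  where c = count (q ∘ fsuc)

length-pairsWithin : ∀ {K} (q : Fin K → Bool) →
  length (filterᵇ (λ p → q (proj₁ p) ∧ q (proj₂ p)) (orderedPairs K)) ≡ count q C 2
length-pairsWithin q =
  ℕtoℚ-injective (trans (ℕtoℚ-length-pairsWithin q) (pairCount≡count-choose-2 q))

mass : ∀ {A : Set} → Dist A → ℚ
mass D = ∑ D proj₂

module _ {A : Set} where

  expect-+ : ∀ (D : Dist A) (X Y : A → ℚ) → expect D (λ a → X a + Y a) ≡ expect D X + expect D Y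
  expect-+ D X Y = trans (∑-cong D (λ (a , p) → *-distribˡ-+ p (X a) (Y a)))
                         (∑-+ D (λ (a , p) → p * X a) (λ (a , p) → p * Y a))

  expect-const : ∀ (D : Dist A) c → expect D (λ _ → c) ≡ mass D * c
  expect-const D c = ∑-*ʳ D c proj₂

  expect-const-prob : ∀ (D : Dist A) → mass D ≡ 1ℚ → ∀ c → expect D (λ _ → c) ≡ c
  expect-const-prob D mass≡1 c = trans (expect-const D c) (trans (cong (_* c) mass≡1) (*-identityˡ c))

module _ {A : Set} (D : Dist A) where

  ∑-iid-suc : ∀ n (f : List A × ℚ → ℚ) →
    ∑ (iid (suc n) D) f ≡ ∑[ (x , p) ∈ D ] ∑[ (xs , q) ∈ iid n D ] f (x ∷ xs , p * q)
  ∑-iid-suc n f = trans (∑-concatMap D _ f) (∑-cong D (λ (x , p) → ∑-map (iid n D) _ f))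

  module _ (mass≡1 : mass D ≡ 1ℚ) where

    mass-iid : ∀ n → mass (iid n D) ≡ 1ℚ
    mass-iid zero    = +-identityʳ 1ℚ
    mass-iid (suc n) = begin
      mass (iid (suc n) D)
        ≡⟨ ∑-iid-suc n proj₂ ⟩
      ∑[ (x , p) ∈ D ] ∑[ (xs , q) ∈ iid n D ] (p * q)
        ≡⟨ ∑-cong D (λ (x , p) → ∑-*ˡ (iid n D) p proj₂) ⟩
      ∑[ (x , p) ∈ D ] (p * mass (iid n D))
        ≡⟨ ∑-cong D (λ (x , p) → trans (cong (p *_) (mass-iid n)) (*-identityʳ p)) ⟩
      mass D
        ≡⟨ mass≡1 ⟩
      1ℚ ∎

    expect-iid-suc : ∀ n (X : List A → ℚ) →
      expect (iid (suc n) D) X ≡ expect D (λ x → expect (iid n D) (X ∘ (x ∷_)))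
    expect-iid-suc n X = trans (∑-iid-suc n (λ (xs , q) → q * X xs))
      (∑-cong D (λ (x , p) → trans (∑-cong (iid n D) (λ (xs , q) → *-assoc p q (X (x ∷ xs))))
                                   (∑-*ˡ (iid n D) p (λ (xs , q) → q * X (x ∷ xs)))))

    expect-iid-sum : ∀ (g : A → ℚ) n →
      expect (iid n D) (λ xs → sumℚ (map g xs)) ≡ ℕtoℚ n * expect D g
    expect-iid-sum g zero    = trans (+-identityʳ _) (trans (*-zeroʳ 1ℚ) (sym (*-zeroˡ (expect D g))))
    expect-iid-sum g (suc n) = begin
      expect (iid (suc n) D) sum-g
        ≡⟨ expect-iid-suc n sum-g ⟩
      expect D (λ x → expect (iid n D) (λ xs → g x + sum-g xs))
        ≡⟨ ∑-cong D (λ (x , p) → cong (p *_) (expect-shift x)) ⟩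
      expect D (λ x → g x + expect (iid n D) sum-g)
        ≡⟨ expect-+ D g (λ _ → expect (iid n D) sum-g) ⟩
      expect D g + expect D (λ _ → expect (iid n D) sum-g)
        ≡⟨ cong (expect D g +_) (expect-const-prob D mass≡1 _) ⟩
      expect D g + expect (iid n D) sum-g
        ≡⟨ cong (expect D g +_) (expect-iid-sum g n) ⟩
      expect D g + ℕtoℚ n * expect D g
        ≡⟨ cong (_+ ℕtoℚ n * expect D g) (*-identityˡ (expect D g)) ⟨
      1ℚ * expect D g + ℕtoℚ n * expect D g
        ≡⟨ *-distribʳ-+ (expect D g) 1ℚ (ℕtoℚ n) ⟨
      (1ℚ + ℕtoℚ n) * expect D g
        ≡⟨ cong (_* expect D g) (ℕtoℚ-suc n) ⟨
      ℕtoℚ (suc n) * expect D g ∎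
      where
      sum-g : List A → ℚ
      sum-g xs = sumℚ (map g xs)

      expect-shift : ∀ x → expect (iid n D) (λ xs → g x + sum-g xs) ≡ g x + expect (iid n D) sum-g
      expect-shift x = trans (expect-+ (iid n D) (λ _ → g x) sum-g)
                         (cong (_+ expect (iid n D) sum-g) (expect-const-prob (iid n D) (mass-iid n) (g x)))

compensated-increment : ∀ {w : ℚ} → w ≢ 0ℚ → ∀ {n} → n ≥ 1 → ∀ m b →
  (ℕtoℚ n * (1ℚ ÷' w)) * (ℕtoℚ m * (if b then w ÷' ℕtoℚ (n ℕ.* m) else 0ℚ))
    ≡ 𝟙 (0 <ᵇ m) * 𝟙 b
compensated-increment {w} w≢0 {n} n≥1 m false = begin
  (ℕtoℚ n * (1ℚ ÷' w)) * (ℕtoℚ m * 0ℚ) ≡⟨ cong ((ℕtoℚ n * (1ℚ ÷' w)) *_) (*-zeroʳ (ℕtoℚ m)) ⟩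
  (ℕtoℚ n * (1ℚ ÷' w)) * 0ℚ            ≡⟨ *-zeroʳ (ℕtoℚ n * (1ℚ ÷' w)) ⟩
  0ℚ                                   ≡⟨ *-zeroʳ (𝟙 (0 <ᵇ m)) ⟨
  𝟙 (0 <ᵇ m) * 0ℚ                      ∎
compensated-increment {w} w≢0 {n} n≥1 zero true =
  trans (cong ((ℕtoℚ n * (1ℚ ÷' w)) *_) (*-zeroˡ (w ÷' ℕtoℚ (n ℕ.* 0))))
        (trans (*-zeroʳ (ℕtoℚ n * (1ℚ ÷' w))) (sym (*-zeroˡ 1ℚ)))
compensated-increment {w} w≢0 {suc n} n≥1 (suc m) true = begin
  (ℕtoℚ (suc n) * (1ℚ ÷' w)) * (ℕtoℚ (suc m) * (w ÷' k))
    ≡⟨ cong (λ x → (ℕtoℚ (suc n) * (1ℚ ÷' w)) * (ℕtoℚ (suc m) * x)) (÷'≡*1÷' w k) ⟩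
  (ℕtoℚ (suc n) * (1ℚ ÷' w)) * (ℕtoℚ (suc m) * (w * (1ℚ ÷' k)))
    ≡⟨ regroup (ℕtoℚ (suc n)) (ℕtoℚ (suc m)) (1ℚ ÷' w) w (1ℚ ÷' k) ⟩
  ((ℕtoℚ (suc n) * ℕtoℚ (suc m)) * (1ℚ ÷' k)) * (w * (1ℚ ÷' w))
    ≡⟨ cong (λ x → (x * (1ℚ ÷' k)) * (w * (1ℚ ÷' w))) (ℕtoℚ-* (suc n) (suc m)) ⟨
  (k * (1ℚ ÷' k)) * (w * (1ℚ ÷' w))
    ≡⟨ cong₂ _*_ (*-1÷'-inverseʳ (ℕtoℚ-≢0 {suc n ℕ.* suc m} ℕ.1+n≢0))
                 (*-1÷'-inverseʳ w≢0) ⟩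
  1ℚ * 1ℚ ∎
  where
  k = ℕtoℚ (suc n ℕ.* suc m)
  open +-*-Solver
  regroup : ∀ a b c d e → (a * c) * (b * (d * e)) ≡ ((a * b) * e) * (d * c)
  regroup = solve 5 (λ a b c d e → (a :* c) :* (b :* (d :* e)) := ((a :* b) :* e) :* (d :* c)) refl

module _ {N K : ℕ} (G : DHypergraph N K) where

  private
    W : ℚ
    W = ℕtoℚ (totalW G)

    meet : Fin K × Fin K → ℚ
    meet pr = ℕtoℚ (meetSize G pr)

  length-pairsAt : ∀ v → length (pairsAt G v) ≡ weight G v
  length-pairsAt v = length-pairsWithin (λ a → lookup (ebar G a) v)

  ∑-pairsAt : ∀ (h : Fin K × Fin K → ℚ) →
              ∑[ v ∈ allFin N ] ∑ (pairsAt G v) h ≡ ∑[ pr ∈ pairs G ] (meet pr * h pr)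
  ∑-pairsAt h = begin
    ∑[ v ∈ allFin N ] ∑ (pairsAt G v) h
      ≡⟨ ∑-cong (allFin N) (λ v → ∑-filterᵇ (pairs G) (both v) h) ⟩
    ∑[ v ∈ allFin N ] ∑[ pr ∈ pairs G ] (𝟙 (both v pr) * h pr)
      ≡⟨ ∑-comm (allFin N) (pairs G) (λ v pr → 𝟙 (both v pr) * h pr) ⟩
    ∑[ pr ∈ pairs G ] ∑[ v ∈ allFin N ] (𝟙 (both v pr) * h pr)
      ≡⟨ ∑-cong (pairs G) (λ pr → ∑-*ʳ (allFin N) (h pr) (λ v → 𝟙 (both v pr))) ⟩
    ∑[ pr ∈ pairs G ] (∑[ v ∈ allFin N ] 𝟙 (both v pr) * h pr)
      ≡⟨ ∑-cong (pairs G) (λ (a , b) →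
           cong (_* h (a , b)) (∑-both-∈≡∣∩∣ (ebar G a) (ebar G b))) ⟩
    ∑[ pr ∈ pairs G ] (meet pr * h pr) ∎
    where
    both : Fin N → Fin K × Fin K → Bool
    both v (a , b) = lookup (ebar G a) v ∧ lookup (ebar G b) v

  totalW≡∑meetSize : totalW G ≡ foldr ℕ._+_ 0 (map (meetSize G) (pairs G))
  totalW≡∑meetSize = ℕtoℚ-injective (begin
    W
      ≡⟨ ℕtoℚ-sum (allFin N) (weight G) ⟩
    ∑[ v ∈ allFin N ] ℕtoℚ (weight G v)
      ≡⟨ ∑-cong (allFin N) (λ v → cong ℕtoℚ (length-pairsAt v)) ⟨
    ∑[ v ∈ allFin N ] ℕtoℚ (length (pairsAt G v))
      ≡⟨ ∑-cong (allFin N) (λ v → ℕtoℚ-length (pairsAt G v)) ⟩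
    ∑[ v ∈ allFin N ] ∑[ _ ∈ pairsAt G v ] 1ℚ
      ≡⟨ ∑-pairsAt (λ _ → 1ℚ) ⟩
    ∑[ pr ∈ pairs G ] (meet pr * 1ℚ)
      ≡⟨ ∑-cong (pairs G) (λ pr → *-identityʳ (meet pr)) ⟩
    ∑[ pr ∈ pairs G ] meet pr
      ≡⟨ ℕtoℚ-sum (pairs G) (meetSize G) ⟨
    ℕtoℚ (foldr ℕ._+_ 0 (map (meetSize G) (pairs G))) ∎)

  length-Ω≤totalW : length (Ω G) ≤ totalW G
  length-Ω≤totalW =
    ℕ.≤-trans (length-filter-pos≤sum (pairs G) (meetSize G))
              (ℕ.≤-reflexive (sym totalW≡∑meetSize))

  expect-step : ∀ (X : Fin K × Fin K → ℚ) →
                expect (step G) (X ∘ proj₂) ≡ (1ℚ ÷' W) * ∑[ pr ∈ pairs G ] (meet pr * X pr)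
  expect-step X = begin
    expect (step G) (X ∘ proj₂)
      ≡⟨ ∑-concatMap (allFin N) _ _ ⟩
    ∑[ v ∈ allFin N ] ∑ (map (λ pr → ((v , pr) , prob v)) (pairsAt G v)) (λ (s , p) → p * X (proj₂ s))
      ≡⟨ ∑-cong (allFin N) (λ v → ∑-map (pairsAt G v) _ _) ⟩
    ∑[ v ∈ allFin N ] ∑[ pr ∈ pairsAt G v ] (prob v * X pr)
      ≡⟨ ∑-cong (allFin N) (λ v → ∑-cong-nonEmpty (pairsAt G v) (λ pos pr →
           cong (_* X pr) (prob-uniform v pos))) ⟩
    ∑[ v ∈ allFin N ] ∑[ pr ∈ pairsAt G v ] ((1ℚ ÷' W) * X pr)
      ≡⟨ ∑-cong (allFin N) (λ v → ∑-*ˡ (pairsAt G v) (1ℚ ÷' W) X) ⟩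
    ∑[ v ∈ allFin N ] ((1ℚ ÷' W) * ∑ (pairsAt G v) X)
      ≡⟨ ∑-*ˡ (allFin N) (1ℚ ÷' W) (λ v → ∑ (pairsAt G v) X) ⟩
    (1ℚ ÷' W) * ∑[ v ∈ allFin N ] ∑ (pairsAt G v) X
      ≡⟨ cong ((1ℚ ÷' W) *_) (∑-pairsAt X) ⟩
    (1ℚ ÷' W) * ∑[ pr ∈ pairs G ] (meet pr * X pr) ∎
    where
    -- Nodes of weight 0 carry no pairs, so the junk value 1 ÷' 0 = 0 in their
    -- probability never contributes.
    prob : Fin N → ℚ
    prob v = (ℕtoℚ (weight G v) ÷' W) * (1ℚ ÷' ℕtoℚ (weight G v))

    prob-uniform : ∀ v → 0 < length (pairsAt G v) → prob v ≡ 1ℚ ÷' W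
    prob-uniform v pos =
      ÷'-*-1÷'-cancel W (ℕtoℚ-≢0 (ℕ.m<n⇒n≢0 (subst (0 <_) (length-pairsAt v) pos)))

  mass-step : totalW G ≢ 0 → mass (step G) ≡ 1ℚ
  mass-step W≢0 = begin
    mass (step G)
      ≡⟨ ∑-cong (step G) (λ (_ , p) → *-identityʳ p) ⟨
    expect (step G) (λ _ → 1ℚ)
      ≡⟨ expect-step (λ _ → 1ℚ) ⟩
    (1ℚ ÷' W) * ∑[ pr ∈ pairs G ] (meet pr * 1ℚ)
      ≡⟨ cong ((1ℚ ÷' W) *_) (∑-cong (pairs G) (λ pr → *-identityʳ (meet pr))) ⟩
    (1ℚ ÷' W) * ∑[ pr ∈ pairs G ] meet pr
      ≡⟨ cong ((1ℚ ÷' W) *_)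
              (trans (cong ℕtoℚ totalW≡∑meetSize) (ℕtoℚ-sum (pairs G) (meetSize G))) ⟨
    (1ℚ ÷' W) * W
      ≡⟨ *-comm (1ℚ ÷' W) W ⟩
    W * (1ℚ ÷' W)
      ≡⟨ *-1÷'-inverseʳ (ℕtoℚ-≢0 W≢0) ⟩
    1ℚ ∎

  expect-increment : totalW G ≢ 0 → ∀ {n} → n ≥ 1 → ∀ i →
                     ℕtoℚ n * expect (step G) (increment G n i) ≡ ℕtoℚ (length (Ωᵢ G i))
  expect-increment W≢0 {n} n≥1 i = begin
    ℕtoℚ n * expect (step G) (increment G n i)
      ≡⟨ cong (ℕtoℚ n *_) (expect-step incr) ⟩
    ℕtoℚ n * ((1ℚ ÷' W) * ∑[ pr ∈ pairs G ] (meet pr * incr pr))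
      ≡⟨ *-assoc (ℕtoℚ n) (1ℚ ÷' W) _ ⟨
    (ℕtoℚ n * (1ℚ ÷' W)) * ∑[ pr ∈ pairs G ] (meet pr * incr pr)
      ≡⟨ ∑-*ˡ (pairs G) (ℕtoℚ n * (1ℚ ÷' W)) (λ pr → meet pr * incr pr) ⟨
    ∑[ pr ∈ pairs G ] ((ℕtoℚ n * (1ℚ ÷' W)) * (meet pr * incr pr))
      ≡⟨ ∑-cong (pairs G) (λ pr →
           compensated-increment (ℕtoℚ-≢0 W≢0) n≥1 (meetSize G pr) (inᵢ pr)) ⟩
    ∑[ pr ∈ pairs G ] (𝟙 (0 <ᵇ meetSize G pr) * 𝟙 (inᵢ pr))
      ≡⟨ ∑-filterᵇ (pairs G) (λ pr → 0 <ᵇ meetSize G pr) (𝟙 ∘ inᵢ) ⟨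
    ∑[ pr ∈ Ω G ] 𝟙 (inᵢ pr)
      ≡⟨ ℕtoℚ-length-filterᵇ (Ω G) inᵢ ⟨
    ℕtoℚ (length (Ωᵢ G i)) ∎
    where
    inᵢ : Fin K × Fin K → Bool
    inᵢ pr = vecEqᵇ (dhg G pr) i

    incr : Fin K × Fin K → ℚ
    incr pr = if inᵢ pr then W ÷' ℕtoℚ (n ℕ.* meetSize G pr) else 0ℚ

proposition6 : ∀ {N K : ℕ} (G : DHypergraph N K) (n : ℕ) →
    0 < length (Ω G) → n ≥ 1 →
    ∀ (i : DHG) → expectedC G n i ≡ ℕtoℚ (length (Ωᵢ G i))
proposition6 G n Ω-nonEmpty n≥1 i = begin
  expectedC G n i
    ≡⟨ expect-iid-sum (step G) (mass-step G W≢0) (increment G n i) n ⟩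
  ℕtoℚ n * expect (step G) (increment G n i)
    ≡⟨ expect-increment G W≢0 n≥1 i ⟩
  ℕtoℚ (length (Ωᵢ G i)) ∎
  where
  W≢0 : totalW G ≢ 0
  W≢0 = ℕ.m<n⇒n≢0 (ℕ.<-≤-trans Ω-nonEmpty (length-Ω≤totalW G))
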